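{- For every $n$-element poset $P$, we have $\partial^{n-1}(\Lambda(P))=\mathcal L(P)$.
   Context: A labeling of a finite $n$-element poset $P$ is a bijection $L:P\to[n]$; $\Lambda(P)$ denotes the set of labelings and $\mathcal L(P)\subseteq\Lambda(P)$ the set of linear extensions (labelings with $L(x)\le L(y)$ whenever $x\le_P y$). For a labeling $L$ and a non-maximal $x\in P$, the $L$-successor of $x$ is the element $y>_P x$ minimizing $L(y)$. The promotion chain of $L$ is $v_1<_P\cdots<_P v_m$, where $v_1=L^{ -1}(1)$, $v_{i+1}$ is the $L$-successor of $v_i$ as long as $v_i$ is not maximal, and $v_m$ is maximal. Extended promotion $\partial:\Lambda(P)\to\Lambda(P)$ is defined by $\partial(L)(x)=L(x)-1$ if $x$ is not in the promotion chain, $\partial(L)(v_i)=L(v_{i+1})-1$ for $1\le i\le m-1$, and $\partial(L)(v_m)=n$. -}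

module Defs where

open import Data.Nat using (ℕ; zero; suc; _∸_; _≤_; _<ᵇ_; _≟_)
open import Data.Fin using (Fin; toℕ)
import Data.Fin as F
open import Data.Fin.Permutation using (Permutation′; _⟨$⟩ʳ_)
open import Data.List using (List; []; _∷_; filter; allFin)
open import Data.List.Relation.Unary.Any using (any?)
open import Data.Maybe using (Maybe; just; nothing)
open import Data.Bool using (if_then_else_)
open import Data.Product using (_×_)
open import Relation.Binary.Core using (Rel)
open import Relation.Binary.Structures using (IsDecPartialOrder)
open import Relation.Binary.PropositionalEquality using (_≡_; _≢_)
open import Relation.Nullary using (Dec; yes; no; ¬_; does)
open import Relation.Nullary.Decidable using (_×-dec_; ¬?)

record FinPoset (n : ℕ) : Set₁ where
  field
    _≤P_ : Rel (Fin n) _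
    isDecPartialOrder : IsDecPartialOrder _≡_ _≤P_

  open IsDecPartialOrder isDecPartialOrder public
    using () renaming (_≤?_ to _≤P?_)

  _<P_ : Rel (Fin n) _
  x <P y = x ≤P y × x ≢ y

  _<P?_ : (x y : Fin n) → Dec (x <P y)
  x <P? y = (x ≤P? y) ×-dec ¬? (x F.≟ y)

-- Labelings are represented by their values in ℕ (labels 1..n);
-- a genuine labeling is the function induced by a bijection Fin n ↔ Fin n.
Lab : ℕ → Set
Lab n = Fin n → ℕ

label : ∀ {n} → Permutation′ n → Lab n
label π x = suc (toℕ (π ⟨$⟩ʳ x))

IsLinExt : ∀ {n} → FinPoset n → Lab n → Set
IsLinExt P L = ∀ x y → x ≤P y → L x ≤ L y
  where open FinPoset P

minBy : ∀ {n} → Lab n → List (Fin n) → Maybe (Fin n)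
minBy L [] = nothing
minBy L (x ∷ xs) with minBy L xs
... | nothing = just x
... | just y = if L y <ᵇ L x then just y else just x

head? : ∀ {n} → List (Fin n) → Maybe (Fin n)
head? [] = nothing
head? (x ∷ _) = just x

module _ {n : ℕ} (P : FinPoset n) where
  open FinPoset P

  successor : Lab n → Fin n → Maybe (Fin n)
  successor L x = minBy L (filter (x <P?_) (allFin n))

  chainFrom : Lab n → ℕ → Fin n → List (Fin n)
  chainFrom L zero x = []
  chainFrom L (suc k) x with successor L x
  ... | nothing = x ∷ []
  ... | just y = x ∷ chainFrom L k y

  promotionChain : Lab n → List (Fin n)
  promotionChain L with head? (filter (λ x → L x ≟ 1) (allFin n))
  ... | nothing = []
  ... | just v₁ = chainFrom L n v₁

  ∂ : Lab n → Lab n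
  ∂ L x with does (any? (x F.≟_) (promotionChain L))
  ... | Data.Bool.false = L x ∸ 1
  ... | Data.Bool.true with successor L x
  ...   | just y = L y ∸ 1
  ...   | nothing = n

iter : ∀ {A : Set} → ℕ → (A → A) → A → A
iter zero f a = a
iter (suc k) f a = f (iter k f a)

module Submission where

-- Promotion permutes labelings: ∂ L = rot ∘ L ∘ c, where c moves each element of the
-- promotion chain to its successor (the maximal one to v₁) and rot lowers every label by
-- one, 1 becoming n.  Call L top-ordered for k if L x < L y whenever x <P y and L x is one
-- of the k largest labels.  Every labeling is top-ordered for 0, and ∂ raises k by one: the
-- new label of x is L w − 1 for w = c x, which is x itself or the smallest-labelled element
-- above x, and any two elements of the promotion chain are comparable.  Top-ordered for
-- n − 1 means linear extension, so ∂ⁿ⁻¹ maps every labeling into 𝓛(P).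
-- Conversely ∂ maps 𝓛(P) onto itself: for a linear extension σ, reverse its labels
-- (L ↦ n + 1 − L), promote in the dual poset and reverse again.  The promotion chain of the
-- result is the dual promotion chain read backwards, so promoting undoes the dual promotion
-- and gives back σ.

open import Defs
open import Data.Bool using (true; false; T)
open import Data.Fin using (Fin; toℕ)
import Data.Fin as F
import Data.Fin.Properties as FinP
open import Data.Fin.Permutation
  using (Permutation′; _⟨$⟩ʳ_; _⟨$⟩ˡ_; _∘ₚ_; transpose; reverse; lift₀; inverseˡ; inverseʳ)
import Data.Fin.Permutation as Perm
import Data.Fin.Permutation.Components as PC
open import Data.List using (List; []; _∷_; filter; allFin; length)
open import Data.List.Properties using (filter-reject; filter-notAll; filter-≐; length-tabulate)
open import Data.List.Membership.Propositional using (_∈_; _∉_)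
open import Data.List.Membership.Propositional.Properties using (∈-filter⁺; ∈-filter⁻; ∈-allFin)
open import Data.List.Relation.Unary.Any as Any using (here; there; any?)
open import Data.Maybe using (just; nothing)
open import Data.Maybe.Properties using (just-injective)
open import Data.Nat
  using (ℕ; zero; suc; _+_; _∸_; _≤_; _<_; z≤n; s≤s; s≤s⁻¹; s<s⁻¹; _<ᵇ_; _≟_; _≤?_)
open import Data.Nat.Properties
open import Data.Product using (_×_; _,_; proj₁; proj₂; ∃)
open import Data.Sum using (_⊎_; inj₁; inj₂)
open import Function using (_∘_)
open import Function.Definitions using (Injective)
open import Relation.Binary.PropositionalEquality
open import Relation.Binary.Structures using (IsDecPartialOrder)
open import Relation.Nullary using (yes; no; ¬_)
open import Relation.Nullary.Decidable using (dec-true; dec-false)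
open import Relation.Nullary.Negation using (contradiction)
open import Relation.Unary using (Pred; Decidable; _⊆_)

minBy-∷≢nothing : ∀ {n} (L : Lab n) x xs → minBy L (x ∷ xs) ≢ nothing
minBy-∷≢nothing L x xs with minBy L xs
... | nothing = λ ()
... | just y with L y <ᵇ L x
...   | true = λ ()
...   | false = λ ()

minBy-∈⇒≢nothing : ∀ {n} (L : Lab n) {z xs} → z ∈ xs → minBy L xs ≢ nothing
minBy-∈⇒≢nothing L {xs = x ∷ xs} _ = minBy-∷≢nothing L x xs

minBy≡just⇒ : ∀ {n} (L : Lab n) xs {y} → minBy L xs ≡ just y →
              y ∈ xs × (∀ {z} → z ∈ xs → L y ≤ L z)
minBy≡just⇒ L (x ∷ xs) eq with minBy L xs in e
... | nothing with refl ← eq = here refl , λ where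
  (here refl) → ≤-refl
  (there z∈xs) → contradiction e (minBy-∈⇒≢nothing L z∈xs)
... | just w with L w <ᵇ L x in w<x | minBy≡just⇒ L xs e
...   | true | w∈xs , w-min with refl ← eq = there w∈xs , λ where
  (here refl) → <⇒≤ (<ᵇ⇒< (L w) (L x) (subst T (sym w<x) _))
  (there z∈xs) → w-min z∈xs
...   | false | _ , w-min with refl ← eq = here refl , λ where
  (here refl) → ≤-refl
  (there z∈xs) → ≤-trans (≮⇒≥ (λ w<x′ → subst T w<x (<⇒<ᵇ w<x′))) (w-min z∈xs)

minBy-cong : ∀ {n} {L L′ : Lab n} → L ≗ L′ → ∀ xs → minBy L xs ≡ minBy L′ xs
minBy-cong L≗L′ [] = refl
minBy-cong {L = L} {L′} L≗L′ (x ∷ xs) with minBy L xs | minBy L′ xs | minBy-cong L≗L′ xs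
... | nothing | .nothing | refl = refl
... | just y | .(just y) | refl rewrite L≗L′ x | L≗L′ y = refl

head?-∈⇒≢nothing : ∀ {n} {z : Fin n} {xs} → z ∈ xs → head? xs ≢ nothing
head?-∈⇒≢nothing {xs = _ ∷ _} _ ()

head?≡just⇒∈ : ∀ {n} {v : Fin n} {xs} → head? xs ≡ just v → v ∈ xs
head?≡just⇒∈ {xs = _ ∷ _} refl = here refl

module _ {p q} {A : Set} {P : Pred A p} {Q : Pred A q}
         (P? : Decidable P) (Q? : Decidable Q) (Q⊆P : Q ⊆ P) where

  filter-filter-⊆ : ∀ xs → filter Q? (filter P? xs) ≡ filter Q? xs
  filter-filter-⊆ [] = refl
  filter-filter-⊆ (x ∷ xs) with P? x
  ... | no ¬px = trans (filter-filter-⊆ xs) (sym (filter-reject Q? (¬px ∘ Q⊆P)))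
  ... | yes _ with Q? x
  ...   | yes _ = cong (x ∷_) (filter-filter-⊆ xs)
  ...   | no _ = filter-filter-⊆ xs

  length-filter-< : ∀ {w xs} → w ∈ xs → P w → ¬ Q w →
                    length (filter Q? xs) < length (filter P? xs)
  length-filter-< {xs = xs} w∈xs pw ¬qw =
    subst (λ ys → length ys < length (filter P? xs)) (filter-filter-⊆ xs)
      (filter-notAll Q? (filter P? xs) (Any.map (λ { refl → ¬qw }) (∈-filter⁺ P? w∈xs pw)))

transpose-left : ∀ {n} (i j : Fin n) → PC.transpose i j i ≡ j
transpose-left i j rewrite dec-true (i F.≟ i) refl = refl

transpose-right : ∀ {n} (i j : Fin n) → PC.transpose i j j ≡ i
transpose-right i j with j F.≟ i
... | yes j≡i = j≡i
... | no _ rewrite dec-true (j F.≟ j) refl = refl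

transpose-other : ∀ {n} {i j k : Fin n} → k ≢ i → k ≢ j → PC.transpose i j k ≡ k
transpose-other {i = i} {j} {k} k≢i k≢j
  rewrite dec-false (k F.≟ i) k≢i | dec-false (k F.≟ j) k≢j = refl

-- For distinct a₁, …, aₘ, cycle (a₁ ∷ … ∷ aₘ) sends aᵢ to aᵢ₊₁ and aₘ to a₁.
cycle : ∀ {n} → List (Fin n) → Permutation′ n
cycle [] = Perm.id
cycle (a ∷ []) = Perm.id
cycle (a ∷ b ∷ r) = cycle (b ∷ r) ∘ₚ transpose a b

cycle-∉ : ∀ {n} {x : Fin n} l → x ∉ l → cycle l ⟨$⟩ʳ x ≡ x
cycle-∉ [] _ = refl
cycle-∉ (a ∷ []) _ = refl
cycle-∉ (a ∷ b ∷ r) x∉l =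
  trans (cong (PC.transpose a b) (cycle-∉ (b ∷ r) (x∉l ∘ there)))
        (transpose-other (x∉l ∘ here) (x∉l ∘ there ∘ here))

-- i ↦ i − 1 and 0 ↦ n − 1
rotate : ∀ n → Permutation′ n
rotate zero = Perm.id
rotate (suc m) = lift₀ reverse ∘ₚ reverse

label-injective : ∀ {n} (π : Permutation′ n) → Injective _≡_ _≡_ (label π)
label-injective π eq =
  trans (sym (inverseˡ π))
        (trans (cong (π ⟨$⟩ˡ_) (FinP.toℕ-injective (suc-injective eq))) (inverseˡ π))

label≤n : ∀ {n} (π : Permutation′ n) x → label π x ≤ n
label≤n π x = FinP.toℕ<n (π ⟨$⟩ʳ x)

label-attains-1 : ∀ {n} (π : Permutation′ n) → Fin n → ∃ λ v → label π v ≡ 1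
label-attains-1 {suc _} π _ = π ⟨$⟩ˡ F.zero , cong (suc ∘ toℕ) (inverseʳ π)

label-∘rotate : ∀ {n} (π : Permutation′ n) x → label π x ≢ 1 →
                label (π ∘ₚ rotate n) x ≡ label π x ∸ 1
label-∘rotate {suc m} π x ≢1 with π ⟨$⟩ʳ x
... | F.zero = contradiction refl ≢1
... | F.suc j =
  cong suc (trans (FinP.opposite-suc (F.opposite j)) (cong toℕ (FinP.opposite-involutive j)))

label-∘rotate-1 : ∀ {n} (π : Permutation′ n) x → label π x ≡ 1 → label (π ∘ₚ rotate n) x ≡ n
label-∘rotate-1 {suc m} π x ≡1 with π ⟨$⟩ʳ x
... | F.zero = cong suc (FinP.toℕ-fromℕ m)

reverseLabel : ∀ {n} → Lab n → Lab n
reverseLabel {n} L x = suc n ∸ L x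

label-∘reverse : ∀ {n} (π : Permutation′ n) → label (π ∘ₚ reverse) ≗ reverseLabel (label π)
label-∘reverse π x =
  trans (cong suc (FinP.opposite-prop (π ⟨$⟩ʳ x))) (sym (+-∸-assoc 1 (FinP.toℕ<n (π ⟨$⟩ʳ x))))

reverseLabel-involutive : ∀ {n} (π : Permutation′ n) →
                          reverseLabel (reverseLabel (label π)) ≗ label π
reverseLabel-involutive π x = m∸[m∸n]≡n (m≤n⇒m≤1+n (label≤n π x))

[m∸n]∸1≡m∸[1+n] : ∀ m n → m ∸ n ∸ 1 ≡ m ∸ suc n
[m∸n]∸1≡m∸[1+n] m n = trans (∸-+-assoc m n 1) (cong (m ∸_) (+-comm n 1))

module Promotion {n : ℕ} (P : FinPoset n) where
  open FinPoset P
  open IsDecPartialOrder isDecPartialOrder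
    using () renaming (refl to ≤P-refl; trans to ≤P-trans; antisym to ≤P-antisym)

  <P-irrefl : ∀ {x} → ¬ x <P x
  <P-irrefl (_ , x≢x) = x≢x refl

  ≤-<P-trans : ∀ {x y z} → x ≤P y → y <P z → x <P z
  ≤-<P-trans x≤y (y≤z , y≢z) = ≤P-trans x≤y y≤z , λ { refl → y≢z (≤P-antisym y≤z x≤y) }

  <P-≤-trans : ∀ {x y z} → x <P y → y ≤P z → x <P z
  <P-≤-trans (x≤y , x≢y) y≤z = ≤P-trans x≤y y≤z , λ { refl → x≢y (≤P-antisym x≤y y≤z) }

  <P-trans : ∀ {x y z} → x <P y → y <P z → x <P z
  <P-trans (x≤y , _) = ≤-<P-trans x≤y

  Maximal : Fin n → Set
  Maximal x = ∀ z → ¬ x <P z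

  module _ {L : Lab n} {x : Fin n} where

    successor≡just⇒ : ∀ {y} → successor P L x ≡ just y →
                      x <P y × (∀ {z} → x <P z → L y ≤ L z)
    successor≡just⇒ eq =
      let y∈ , y-min = minBy≡just⇒ L (filter (x <P?_) (allFin n)) eq in
      proj₂ (∈-filter⁻ (x <P?_) {xs = allFin n} y∈) ,
      λ x<z → y-min (∈-filter⁺ (x <P?_) (∈-allFin _) x<z)

    successor≡nothing⇒maximal : successor P L x ≡ nothing → Maximal x
    successor≡nothing⇒maximal eq z x<z =
      minBy-∈⇒≢nothing L (∈-filter⁺ (x <P?_) (∈-allFin z) x<z) eq

    successor-intro : ∀ {y} → Injective _≡_ _≡_ L → x <P y → (∀ {z} → x <P z → L y ≤ L z) →
                      successor P L x ≡ just y
    successor-intro {y} L-inj x<y y-min with successor P L x in e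
    ... | nothing = contradiction x<y (successor≡nothing⇒maximal e y)
    ... | just w = let x<w , w-min = successor≡just⇒ e in
                   cong just (L-inj (≤-antisym (w-min x<y) (y-min x<w)))

    maximal⇒successor≡nothing : Maximal x → successor P L x ≡ nothing
    maximal⇒successor≡nothing x-max with successor P L x in e
    ... | nothing = refl
    ... | just w = contradiction (proj₁ (successor≡just⇒ e)) (x-max w)

  successor-cong : ∀ {L L′} → L ≗ L′ → ∀ x → successor P L x ≡ successor P L′ x
  successor-cong L≗L′ x = minBy-cong L≗L′ (filter (x <P?_) (allFin n))

  #above : Fin n → ℕ
  #above x = length (filter (x <P?_) (allFin n))

  #above-< : ∀ {x y} → x <P y → #above y < #above x
  #above-< {x} {y} x<y =
    length-filter-< (x <P?_) (y <P?_) (<P-trans x<y) (∈-allFin y) x<y <P-irrefl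

  #above<n : ∀ x → #above x < n
  #above<n x = subst (#above x <_) (length-tabulate {n = n} (λ i → i))
    (filter-notAll (x <P?_) (allFin n) (Any.map (λ { refl → <P-irrefl }) (∈-allFin x)))

  data SuccChain (L : Lab n) : Fin n → List (Fin n) → Set where
    last : ∀ {x} → successor P L x ≡ nothing → SuccChain L x (x ∷ [])
    next : ∀ {x y l} → successor P L x ≡ just y → SuccChain L y l → SuccChain L x (x ∷ l)

  chainFrom-SuccChain : ∀ L k x → #above x < k → SuccChain L x (chainFrom P L k x)
  chainFrom-SuccChain L (suc k) x #x<1+k with successor P L x in e
  ... | nothing = last e
  ... | just y = next e (chainFrom-SuccChain L k y
                   (≤-trans (#above-< (proj₁ (successor≡just⇒ e))) (s≤s⁻¹ #x<1+k)))

  promotionChain-SuccChain : ∀ L {v} → L v ≡ 1 →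
                             ∃ λ v₁ → L v₁ ≡ 1 × SuccChain L v₁ (promotionChain P L)
  promotionChain-SuccChain L {v} Lv≡1 with head? (filter (λ x → L x ≟ 1) (allFin n)) in e
  ... | nothing =
    contradiction e (head?-∈⇒≢nothing (∈-filter⁺ (λ x → L x ≟ 1) (∈-allFin v) Lv≡1))
  ... | just v₁ = v₁ , proj₂ (∈-filter⁻ (λ x → L x ≟ 1) {xs = allFin n} (head?≡just⇒∈ e))
                     , chainFrom-SuccChain L n v₁ (#above<n v₁)

  module _ {L : Lab n} where

    SuccChain-head : ∀ {h l} → SuccChain L h l → ∃ λ r → l ≡ h ∷ r
    SuccChain-head (last _) = _ , refl
    SuccChain-head (next _ _) = _ , refl

    SuccChain-head∈ : ∀ {h l} → SuccChain L h l → h ∈ l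
    SuccChain-head∈ c with _ , refl ← SuccChain-head c = here refl

    SuccChain-above : ∀ {h l z} → SuccChain L h l → z ∈ l → h ≤P z
    SuccChain-above (last _) (here refl) = ≤P-refl
    SuccChain-above (next _ _) (here refl) = ≤P-refl
    SuccChain-above (next e c) (there z∈l) =
      ≤P-trans (proj₁ (proj₁ (successor≡just⇒ e))) (SuccChain-above c z∈l)

    SuccChain-strictlyAbove : ∀ {h y l z} → successor P L h ≡ just y → SuccChain L y l →
                              z ∈ l → h <P z
    SuccChain-strictlyAbove e c z∈l = <P-≤-trans (proj₁ (successor≡just⇒ e)) (SuccChain-above c z∈l)

    SuccChain-total : ∀ {h l x z} → SuccChain L h l → x ∈ l → z ∈ l → x ≤P z ⊎ z ≤P x
    SuccChain-total c@(last _) (here refl) z∈l = inj₁ (SuccChain-above c z∈l)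
    SuccChain-total c@(next _ _) (here refl) z∈l = inj₁ (SuccChain-above c z∈l)
    SuccChain-total c@(next _ _) (there x∈l) (here refl) = inj₂ (SuccChain-above c (there x∈l))
    SuccChain-total (next _ c) (there x∈l) (there z∈l) = SuccChain-total c x∈l z∈l

    SuccChain-closed : ∀ {h l x y} → SuccChain L h l → x ∈ l → successor P L x ≡ just y → y ∈ l
    SuccChain-closed (last e) (here refl) e′ = contradiction (trans (sym e) e′) λ ()
    SuccChain-closed (next e c) (here refl) e′ =
      there (subst (_∈ _) (just-injective (trans (sym e) e′)) (SuccChain-head∈ c))
    SuccChain-closed (next _ c) (there x∈l) e′ = there (SuccChain-closed c x∈l e′)

    SuccChain-predecessor : ∀ {h l z} → SuccChain L h l → z ∈ l →
                            z ≡ h ⊎ ∃ λ x → x ∈ l × successor P L x ≡ just z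
    SuccChain-predecessor (last _) (here refl) = inj₁ refl
    SuccChain-predecessor (next _ _) (here refl) = inj₁ refl
    SuccChain-predecessor (next e c) (there z∈l) with SuccChain-predecessor c z∈l
    ... | inj₁ refl = inj₂ (_ , here refl , e)
    ... | inj₂ (x , x∈l , ex) = inj₂ (x , there x∈l , ex)

    SuccChain-induction : ∀ {h l} (S : Fin n → Set) → SuccChain L h l → S h →
                          (∀ {x y} → S x → successor P L x ≡ just y → S y) →
                          ∀ {z} → z ∈ l → S z
    SuccChain-induction S (last _) Sh step (here refl) = Sh
    SuccChain-induction S (next _ _) Sh step (here refl) = Sh
    SuccChain-induction S (next e c) Sh step (there z∈l) =
      SuccChain-induction S c (step Sh e) step z∈l

    SuccChain-backInduction : ∀ {h l} (S : Fin n → Set) → SuccChain L h l →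
                              (∀ {t} → t ∈ l → successor P L t ≡ nothing → S t) →
                              (∀ {x y} → x ∈ l → successor P L x ≡ just y → S y → S x) →
                              ∀ {z} → z ∈ l → S z
    SuccChain-backInduction S (last e) top step (here refl) = top (here refl) e
    SuccChain-backInduction S (next e c) top step z∈l with z∈l
    ... | here refl = step (here refl) e (S-tail (SuccChain-head∈ c))
      where S-tail = SuccChain-backInduction S c (top ∘ there) (step ∘ there)
    ... | there z∈l′ = SuccChain-backInduction S c (top ∘ there) (step ∘ there) z∈l′

    cycle-successor : ∀ {h l x y} → SuccChain L h l → x ∈ l → successor P L x ≡ just y →
                      cycle l ⟨$⟩ʳ x ≡ y
    cycle-successor (last e) (here refl) e′ = contradiction (trans (sym e) e′) λ ()
    cycle-successor {h} (next {y = h′} e c) x∈l e′ with _ , refl ← SuccChain-head c | x∈l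
    ... | here refl =
      trans (cong (PC.transpose h h′) (cycle-∉ _ (<P-irrefl ∘ SuccChain-strictlyAbove e c)))
            (trans (transpose-left h h′) (just-injective (trans (sym e) e′)))
    ... | there x∈l′ =
      trans (cong (PC.transpose h h′) (cycle-successor c x∈l′ e′)) (transpose-other y≢h y≢h′)
      where
      y≢h : _ ≢ h
      y≢h refl = <P-irrefl (SuccChain-strictlyAbove e c (SuccChain-closed c x∈l′ e′))
      y≢h′ : _ ≢ h′
      y≢h′ refl = <P-irrefl (≤-<P-trans (SuccChain-above c x∈l′) (proj₁ (successor≡just⇒ e′)))

    cycle-last : ∀ {h l x} → SuccChain L h l → x ∈ l → successor P L x ≡ nothing →
                 cycle l ⟨$⟩ʳ x ≡ h
    cycle-last (last _) (here refl) _ = refl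
    cycle-last (next e _) (here refl) e′ = contradiction (trans (sym e′) e) λ ()
    cycle-last {h} (next {y = h′} _ c) (there x∈l) e′ with _ , refl ← SuccChain-head c =
      trans (cong (PC.transpose h h′) (cycle-last c x∈l e′)) (transpose-right h h′)

  data ∂-Spec (L : Lab n) (x : Fin n) : ℕ → Set where
    off-chain : x ∉ promotionChain P L → ∂-Spec L x (L x ∸ 1)
    on-chain  : ∀ {y} → x ∈ promotionChain P L → successor P L x ≡ just y → ∂-Spec L x (L y ∸ 1)
    chain-top : x ∈ promotionChain P L → successor P L x ≡ nothing → ∂-Spec L x n

  ∂-spec : ∀ L x → ∂-Spec L x (∂ P L x)
  ∂-spec L x with any? (x F.≟_) (promotionChain P L)
  ... | no x∉C = off-chain x∉C
  ... | yes x∈C with successor P L x in e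
  ...   | just _ = on-chain x∈C e
  ...   | nothing = chain-top x∈C e

  module _ {L : Lab n} {x : Fin n} where

    ∂-off-chain : x ∉ promotionChain P L → ∂ P L x ≡ L x ∸ 1
    ∂-off-chain x∉C with ∂ P L x | ∂-spec L x
    ... | _ | off-chain _ = refl
    ... | _ | on-chain x∈C _ = contradiction x∈C x∉C
    ... | _ | chain-top x∈C _ = contradiction x∈C x∉C

    ∂-on-chain : ∀ {y} → x ∈ promotionChain P L → successor P L x ≡ just y → ∂ P L x ≡ L y ∸ 1
    ∂-on-chain x∈C e with ∂ P L x | ∂-spec L x
    ... | _ | off-chain x∉C = contradiction x∈C x∉C
    ... | _ | on-chain _ e′ = cong (λ w → L w ∸ 1) (just-injective (trans (sym e′) e))
    ... | _ | chain-top _ e′ = contradiction (trans (sym e′) e) λ ()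

    ∂-chain-top : x ∈ promotionChain P L → successor P L x ≡ nothing → ∂ P L x ≡ n
    ∂-chain-top x∈C e with ∂ P L x | ∂-spec L x
    ... | _ | off-chain x∉C = contradiction x∈C x∉C
    ... | _ | on-chain _ e′ = contradiction (trans (sym e) e′) λ ()
    ... | _ | chain-top _ _ = refl

  module _ {L L′ : Lab n} (L≗L′ : L ≗ L′) where

    chainFrom-cong : ∀ k x → chainFrom P L k x ≡ chainFrom P L′ k x
    chainFrom-cong zero x = refl
    chainFrom-cong (suc k) x with successor P L x | successor P L′ x | successor-cong L≗L′ x
    ... | nothing | .nothing | refl = refl
    ... | just y | .(just y) | refl = cong (x ∷_) (chainFrom-cong k y)

    promotionChain-cong : promotionChain P L ≡ promotionChain P L′
    promotionChain-cong
      with head? (filter (λ x → L x ≟ 1) (allFin n)) | head? (filter (λ x → L′ x ≟ 1) (allFin n))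
         | cong head? (filter-≐ (λ x → L x ≟ 1) (λ x → L′ x ≟ 1)
                        ((λ {x} → trans (sym (L≗L′ x))) , (λ {x} → trans (L≗L′ x))) (allFin n))
    ... | nothing | .nothing | refl = refl
    ... | just v | .(just v) | refl = chainFrom-cong n v

    ∂-cong : ∂ P L ≗ ∂ P L′
    ∂-cong x with ∂ P L x | ∂-spec L x
    ... | _ | off-chain x∉C =
      trans (cong (_∸ 1) (L≗L′ x)) (sym (∂-off-chain (x∉C ∘ subst (x ∈_) (sym promotionChain-cong))))
    ... | _ | on-chain x∈C e =
      trans (cong (_∸ 1) (L≗L′ _))
            (sym (∂-on-chain (subst (x ∈_) promotionChain-cong x∈C)
                             (trans (sym (successor-cong L≗L′ x)) e)))
    ... | _ | chain-top x∈C e =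
      sym (∂-chain-top (subst (x ∈_) promotionChain-cong x∈C) (trans (sym (successor-cong L≗L′ x)) e))

  module _ (π : Permutation′ n) where
    private
      L = label π

    labelChain : Fin n → ∃ λ v₁ → L v₁ ≡ 1 × SuccChain L v₁ (promotionChain P L)
    labelChain x = promotionChain-SuccChain L (proj₂ (label-attains-1 π x))

    label≡1⇒∈promotionChain : ∀ {x} → L x ≡ 1 → x ∈ promotionChain P L
    label≡1⇒∈promotionChain {x} Lx≡1 with _ , Lv₁≡1 , c ← labelChain x =
      subst (_∈ _) (label-injective π (trans Lv₁≡1 (sym Lx≡1))) (SuccChain-head∈ c)

  promote : Permutation′ n → Permutation′ n
  promote π = cycle (promotionChain P (label π)) ∘ₚ π ∘ₚ rotate n

  ∂-promote : ∀ π → ∂ P (label π) ≗ label (promote π)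
  ∂-promote π x with ∂ P (label π) x | ∂-spec (label π) x | labelChain π x
  ... | _ | off-chain x∉C | _ =
    trans (sym (label-∘rotate π x (x∉C ∘ label≡1⇒∈promotionChain π)))
          (cong (label (π ∘ₚ rotate n)) (sym (cycle-∉ _ x∉C)))
  ... | _ | on-chain {y} x∈C e | v₁ , Lv₁≡1 , c =
    trans (sym (label-∘rotate π y Ly≢1)) (cong (label (π ∘ₚ rotate n)) (sym (cycle-successor c x∈C e)))
    where
    Ly≢1 : label π y ≢ 1
    Ly≢1 Ly≡1 = <P-irrefl (subst (v₁ <P_) (label-injective π (trans Ly≡1 (sym Lv₁≡1)))
                                 (≤-<P-trans (SuccChain-above c x∈C) (proj₁ (successor≡just⇒ e))))
  ... | _ | chain-top x∈C e | v₁ , Lv₁≡1 , c =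
    trans (sym (label-∘rotate-1 π v₁ Lv₁≡1))
          (cong (label (π ∘ₚ rotate n)) (sym (cycle-last c x∈C e)))

  TopOrdered : ℕ → Lab n → Set
  TopOrdered k L = ∀ {x y} → x <P y → n < L x + k → L x < L y

  TopOrdered-cong : ∀ {k L L′} → L ≗ L′ → TopOrdered k L → TopOrdered k L′
  TopOrdered-cong {k} L≗L′ ord {x} {y} x<y top =
    subst₂ _<_ (L≗L′ x) (L≗L′ y) (ord x<y (subst (λ a → n < a + k) (sym (L≗L′ x)) top))

  module _ (π : Permutation′ n) {k : ℕ} (ord : TopOrdered k (label π)) where
    private
      L = label π

    ∂-lowerBound : ∀ {s y} → (y ∉ promotionChain P L → L s < L y) →
                   (∀ {y′} → y ∈ promotionChain P L → successor P L y ≡ just y′ → L s < L y′) →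
                   L s ∸ 1 < ∂ P L y
    ∂-lowerBound {s} {y} off on with ∂ P L y | ∂-spec L y
    ... | _ | off-chain y∉C = s<s⁻¹ (off y∉C)
    ... | _ | on-chain y∈C e = s<s⁻¹ (on y∈C e)
    ... | _ | chain-top _ _ = FinP.toℕ<n (π ⟨$⟩ʳ s)

    -- x′ and y are comparable, being on the chain, and y <P x′ would contradict L x′ ≤ L y.
    successor-<-on-chain : ∀ {x y x′ y′} → x ∈ promotionChain P L → y ∈ promotionChain P L →
                           x <P y → successor P L x ≡ just x′ → successor P L y ≡ just y′ →
                           n < L x′ + k → L x′ < L y′
    successor-<-on-chain {x} {y} {x′} x∈C y∈C x<y ex ey top
      with _ , _ , c ← labelChain π x
         | SuccChain-total c (SuccChain-closed c x∈C ex) y∈C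
    ... | inj₁ x′≤y = ord (≤-<P-trans x′≤y (proj₁ (successor≡just⇒ ey))) top
    ... | inj₂ y≤x′ with y F.≟ x′
    ...   | yes refl = ord (proj₁ (successor≡just⇒ ey)) top
    ...   | no y≢x′ =
      contradiction (ord (y≤x′ , y≢x′) (<-≤-trans top (+-monoˡ-≤ k Lx′≤Ly))) (≤⇒≯ Lx′≤Ly)
      where Lx′≤Ly = proj₂ (successor≡just⇒ ex) x<y

    ∂-topOrdered : TopOrdered (suc k) (∂ P L)
    ∂-topOrdered {x} {y} x<y top with ∂ P L x | ∂-spec L x
    ... | _ | chain-top _ e = contradiction x<y (successor≡nothing⇒maximal e y)
    ... | _ | off-chain _ = ∂-lowerBound
      (λ _ → ord x<y top′)
      (λ _ ey → ord (<P-trans x<y (proj₁ (successor≡just⇒ ey))) top′)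
      where top′ = subst (n <_) (+-suc (toℕ (π ⟨$⟩ʳ x)) k) top
    ... | _ | on-chain {x′} x∈C ex = ∂-lowerBound
      (λ y∉C → ≤∧≢⇒< (proj₂ (successor≡just⇒ ex) x<y)
                      (λ Lx′≡Ly → y∉C (subst (_∈ _) (label-injective π Lx′≡Ly) x′∈C)))
      (λ y∈C ey → successor-<-on-chain x∈C y∈C x<y ex ey top′)
      where top′ = subst (n <_) (+-suc (toℕ (π ⟨$⟩ʳ x′)) k) top
            x′∈C = SuccChain-closed (proj₂ (proj₂ (labelChain π x))) x∈C ex

  promote-topOrdered : ∀ {k} π → TopOrdered k (label π) → TopOrdered (suc k) (label (promote π))
  promote-topOrdered π ord = TopOrdered-cong (∂-promote π) (∂-topOrdered π ord)

  topOrdered-0 : ∀ π → TopOrdered 0 (label π)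
  topOrdered-0 π {x} _ top =
    contradiction (subst (n <_) (+-identityʳ _) top) (≤⇒≯ (label≤n π x))

  IsLinExt⇒TopOrdered : ∀ {k} π → IsLinExt P (label π) → TopOrdered k (label π)
  IsLinExt⇒TopOrdered π lin (x≤y , x≢y) _ = ≤∧≢⇒< (lin _ _ x≤y) (x≢y ∘ label-injective π)

  TopOrdered⇒IsLinExt : ∀ {k} π → n ∸ 1 ≤ k → TopOrdered k (label π) → IsLinExt P (label π)
  TopOrdered⇒IsLinExt {k} π n∸1≤k ord x y x≤y with x F.≟ y
  ... | yes refl = ≤-refl
  ... | no x≢y with label π x ≤? 1
  ...   | yes Lx≤1 = ≤-trans Lx≤1 (s≤s z≤n)
  ...   | no Lx≰1 = <⇒≤ (ord (x≤y , x≢y) (begin-strict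
    n                 ≤⟨ m≤n+m∸n n 1 ⟩
    1 + (n ∸ 1)       ≤⟨ +-monoʳ-≤ 1 n∸1≤k ⟩
    1 + k             <⟨ +-monoˡ-< k (≰⇒> Lx≰1) ⟩
    label π x + k     ∎))
    where open ≤-Reasoning

  promote-IsLinExt : ∀ π → IsLinExt P (label π) → IsLinExt P (label (promote π))
  promote-IsLinExt π lin =
    TopOrdered⇒IsLinExt (promote π) (n≤1+n _) (promote-topOrdered π (IsLinExt⇒TopOrdered π lin))

  label-iter-promote : ∀ k π → label (iter k promote π) ≗ iter k (∂ P) (label π)
  label-iter-promote zero π x = refl
  label-iter-promote (suc k) π x =
    trans (sym (∂-promote (iter k promote π) x)) (∂-cong (label-iter-promote k π) x)

  topOrdered-iter-promote : ∀ k π → TopOrdered k (label (iter k promote π))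
  topOrdered-iter-promote zero π = topOrdered-0 π
  topOrdered-iter-promote (suc k) π =
    promote-topOrdered (iter k promote π) (topOrdered-iter-promote k π)

  iter-promote-IsLinExt : ∀ π → IsLinExt P (label (iter (n ∸ 1) promote π))
  iter-promote-IsLinExt π =
    TopOrdered⇒IsLinExt (iter (n ∸ 1) promote π) ≤-refl (topOrdered-iter-promote (n ∸ 1) π)

dual : ∀ {n} → FinPoset n → FinPoset n
dual P = record
  { _≤P_ = λ x y → y ≤P x
  ; isDecPartialOrder = record
    { isPartialOrder = record
      { isPreorder = record
        { isEquivalence = isEquivalence
        ; reflexive = λ x≡y → reflexive (sym x≡y)
        ; trans = λ x≥y y≥z → ≤P-trans y≥z x≥y
        }
      ; antisym = λ x≥y y≥x → antisym y≥x x≥y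
      }
    ; _≟_ = F._≟_
    ; _≤?_ = λ x y → y ≤P? x
    }
  }
  where
  open FinPoset P
  open IsDecPartialOrder isDecPartialOrder using (reflexive; antisym)
    renaming (trans to ≤P-trans)

IsLinExt-reverse : ∀ {n} {P Q : FinPoset n} →
                   (∀ {x y} → FinPoset._≤P_ Q x y → FinPoset._≤P_ P y x) →
                   ∀ π → IsLinExt P (label π) → IsLinExt Q (label (π ∘ₚ reverse))
IsLinExt-reverse {n} Q⇒Pᵒᵖ π lin x y x≤y =
  subst₂ _≤_ (sym (label-∘reverse π x)) (sym (label-∘reverse π y))
         (∸-monoʳ-≤ (suc n) (lin y x (Q⇒Pᵒᵖ x≤y)))

module Duality {n : ℕ} (P : FinPoset n) where
  open FinPoset P
  module Primal = Promotion P
  module Dual = Promotion (dual P)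
  open Primal using (off-chain; on-chain; chain-top)
  open Dual using (off-chain; on-chain; chain-top)
  open FinPoset (dual P) using () renaming (_<P_ to _<ᵈ_)

  private
    <⇒>ᵈ : ∀ {x y} → x <P y → y <ᵈ x
    <⇒>ᵈ (x≤y , x≢y) = x≤y , x≢y ∘ sym

    >ᵈ⇒< : ∀ {x y} → y <ᵈ x → x <P y
    >ᵈ⇒< (x≤y , y≢x) = x≤y , y≢x ∘ sym

  module _ (σ : Permutation′ n) (σ-lin : IsLinExt (dual P) (label σ)) where
    private
      Lσ = label σ
      ∂σ = ∂ (dual P) Lσ
      Cσ = promotionChain (dual P) Lσ
      R = label (Dual.promote σ ∘ₚ reverse)
      C* = promotionChain P R

      R≡ : ∀ x → R x ≡ suc n ∸ ∂σ x
      R≡ x = trans (label-∘reverse (Dual.promote σ) x) (cong (suc n ∸_) (sym (Dual.∂-promote σ x)))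

      R-antitone : ∀ {a b} → ∂σ b ≤ ∂σ a → R a ≤ R b
      R-antitone {a} {b} le = subst₂ _≤_ (sym (R≡ a)) (sym (R≡ b)) (∸-monoʳ-≤ (suc n) le)

      σ-mono : ∀ {x y} → x <ᵈ y → Lσ x < Lσ y
      σ-mono (x≤ᵈy , x≢y) = ≤∧≢⇒< (σ-lin _ _ x≤ᵈy) (x≢y ∘ label-injective σ)

      ∂σ≤ : ∀ {z y} → z <ᵈ y → ∂σ z ≤ Lσ y ∸ 1
      ∂σ≤ {z} {y} z<y with ∂σ z | Dual.∂-spec Lσ z
      ... | _ | off-chain _ = ∸-monoˡ-≤ 1 (<⇒≤ (σ-mono z<y))
      ... | _ | on-chain _ e = ∸-monoˡ-≤ 1 (proj₂ (Dual.successor≡just⇒ e) z<y)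
      ... | _ | chain-top _ e = contradiction z<y (Dual.successor≡nothing⇒maximal e y)

      reverse-successor : ∀ {x y} → x ∈ Cσ → successor (dual P) Lσ x ≡ just y →
                          successor P R y ≡ just x
      reverse-successor {x} {y} x∈Cσ e =
        Primal.successor-intro (label-injective (Dual.promote σ ∘ₚ reverse))
          (>ᵈ⇒< (proj₁ (Dual.successor≡just⇒ e)))
          (λ {z} y<z → R-antitone
            (subst (∂σ z ≤_) (sym (Dual.∂-on-chain x∈Cσ e)) (∂σ≤ (<⇒>ᵈ y<z))))

      reverse-shift : ∀ {w x} → ∂σ w ≡ Lσ x ∸ 1 → R w ∸ 1 ≡ suc n ∸ Lσ x
      reverse-shift {w} {x} eq =
        trans (cong (_∸ 1) (trans (R≡ w) (cong (suc n ∸_) eq)))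
              ([m∸n]∸1≡m∸[1+n] (suc n) (toℕ (σ ⟨$⟩ʳ x)))

      module _ {v₁ h*} (σv₁≡1 : Lσ v₁ ≡ 1) (c : Dual.SuccChain Lσ v₁ Cσ)
               (Rh*≡1 : R h* ≡ 1) (c* : Primal.SuccChain R h* C*) where

        v₁-maximal : successor P R v₁ ≡ nothing
        v₁-maximal = Primal.maximal⇒successor≡nothing λ z v₁<z →
          <⇒≱ (subst (Lσ z <_) σv₁≡1 (σ-mono (<⇒>ᵈ v₁<z))) (s≤s z≤n)

        h*∈Cσ : h* ∈ Cσ
        h*∈Cσ with any? (h* F.≟_) Cσ
        ... | yes h*∈ = h*∈
        ... | no h*∉ = contradiction Rh*≡1 (>⇒≢ (begin-strict
          1                          ≡⟨ m+n∸n≡m 1 n ⟨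
          suc n ∸ n                  <⟨ ∸-monoʳ-< (FinP.toℕ<n (σ ⟨$⟩ʳ h*)) (n≤1+n n) ⟩
          suc n ∸ (Lσ h* ∸ 1)        ≡⟨ cong (suc n ∸_) (Dual.∂-off-chain h*∉) ⟨
          suc n ∸ ∂σ h*              ≡⟨ R≡ h* ⟨
          R h*                       ∎))
          where open ≤-Reasoning

        C*⊆Cσ : ∀ {z} → z ∈ C* → z ∈ Cσ
        C*⊆Cσ = Primal.SuccChain-induction (_∈ Cσ) c* h*∈Cσ step
          where
          step : ∀ {x y} → x ∈ Cσ → successor P R x ≡ just y → y ∈ Cσ
          step x∈Cσ e with Dual.SuccChain-predecessor c x∈Cσ
          ... | inj₁ refl = contradiction (trans (sym v₁-maximal) e) λ ()
          ... | inj₂ (x₀ , x₀∈Cσ , e₀) =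
            subst (_∈ Cσ) (just-injective (trans (sym (reverse-successor x₀∈Cσ e₀)) e)) x₀∈Cσ

        Cσ⊆C* : ∀ {z} → z ∈ Cσ → z ∈ C*
        Cσ⊆C* = Dual.SuccChain-backInduction (_∈ C*) c top step
          where
          top : ∀ {t} → t ∈ Cσ → successor (dual P) Lσ t ≡ nothing → t ∈ C*
          top {t} t∈Cσ e =
            subst (_∈ C*) (label-injective (Dual.promote σ ∘ₚ reverse) (trans Rh*≡1 (sym Rt≡1)))
                  (Primal.SuccChain-head∈ c*)
            where
            Rt≡1 = trans (R≡ t) (trans (cong (suc n ∸_) (Dual.∂-chain-top t∈Cσ e)) (m+n∸n≡m 1 n))
          step : ∀ {x y} → x ∈ Cσ → successor (dual P) Lσ x ≡ just y → y ∈ C* → x ∈ C*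
          step x∈Cσ e y∈C* = Primal.SuccChain-closed c* y∈C* (reverse-successor x∈Cσ e)

        ∂R≗reverseLabel : ∂ P R ≗ reverseLabel Lσ
        ∂R≗reverseLabel x with ∂ P R x | Primal.∂-spec R x
        ... | _ | off-chain x∉C* = reverse-shift (Dual.∂-off-chain (x∉C* ∘ Cσ⊆C*))
        ... | _ | on-chain x∈C* e with Dual.SuccChain-predecessor c (C*⊆Cσ x∈C*)
        ...   | inj₁ refl = contradiction (trans (sym v₁-maximal) e) λ ()
        ...   | inj₂ (x₀ , x₀∈Cσ , e₀) with refl ← trans (sym e) (reverse-successor x₀∈Cσ e₀) =
          reverse-shift (Dual.∂-on-chain x₀∈Cσ e₀)
        ∂R≗reverseLabel x | _ | chain-top x∈C* e with Dual.SuccChain-predecessor c (C*⊆Cσ x∈C*)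
        ...   | inj₁ refl = cong (suc n ∸_) (sym σv₁≡1)
        ...   | inj₂ (x₀ , x₀∈Cσ , e₀) =
          contradiction (trans (sym e) (reverse-successor x₀∈Cσ e₀)) λ ()

    ∂-reverse-promote : ∂ P (label (Dual.promote σ ∘ₚ reverse)) ≗ reverseLabel (label σ)
    ∂-reverse-promote x
      with _ , σv₁≡1 , c ← Dual.labelChain σ x
         | _ , Rh*≡1 , c* ← Primal.labelChain (Dual.promote σ ∘ₚ reverse) x =
      ∂R≗reverseLabel σv₁≡1 c Rh*≡1 c* x

  linExt-∂-preimage : ∀ σ → IsLinExt P (label σ) →
                      ∃ λ τ → IsLinExt P (label τ) × ∂ P (label τ) ≗ label σ
  linExt-∂-preimage σ lin = Dual.promote σᵒ ∘ₚ reverse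
    , IsLinExt-reverse {P = dual P} {P} (λ x≤y → x≤y) (Dual.promote σᵒ)
                       (Dual.promote-IsLinExt σᵒ linᵒ)
    , λ x → trans (∂-reverse-promote σᵒ linᵒ x)
                  (trans (cong (suc n ∸_) (label-∘reverse σ x)) (reverseLabel-involutive σ x))
    where
    σᵒ : Permutation′ n
    σᵒ = σ ∘ₚ reverse
    linᵒ : IsLinExt (dual P) (label σᵒ)
    linᵒ = IsLinExt-reverse {P = P} {dual P} (λ x≥y → x≥y) σ lin

  linExt-∂-iter-preimage : ∀ j σ → IsLinExt P (label σ) →
                           ∃ λ π → label σ ≗ iter j (∂ P) (label π)
  linExt-∂-iter-preimage zero σ _ = σ , λ _ → refl
  linExt-∂-iter-preimage (suc j) σ lin =
    let τ , τ-lin , ∂τ≗σ = linExt-∂-preimage σ lin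
        π , τ≗ = linExt-∂-iter-preimage j τ τ-lin
    in π , λ x → trans (sym (∂τ≗σ x)) (Primal.∂-cong τ≗ x)

proposition2p7 : (n : ℕ) (P : FinPoset n) →
    ((π : Permutation′ n) → ∃ λ (σ : Permutation′ n) →
        (label σ ≗ iter (n ∸ 1) (∂ P) (label π)) × IsLinExt P (label σ))
    × ((σ : Permutation′ n) → IsLinExt P (label σ) →
        ∃ λ (π : Permutation′ n) → label σ ≗ iter (n ∸ 1) (∂ P) (label π))
proposition2p7 n P =
  (λ π → iter (n ∸ 1) promote π , label-iter-promote (n ∸ 1) π , iter-promote-IsLinExt π)
  , linExt-∂-iter-preimage (n ∸ 1)
  where
  open Promotion P
  open Duality P
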